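{- Let $\mathcal F$ be a $1$-dense union-closed family over $[n]$, and let $\mathcal G$ be the family of all inclusion-wise minimal members of $\mathcal F$. Let $A,B\in\langle\mathcal G\rangle_{\mathcal F}$ with $A\subseteq B$. Then $A\subseteq_{\mathcal F}B$.
   Context: A family of subsets of $[n]$ is union-closed over $[n]$ if it contains $[n]$ and is closed under pairwise unions; the empty set is never a member of any family, and $2^{[n]}$ denotes all nonempty subsets of $[n]$. The closure of $\mathcal F$ is $\overline{\mathcal F}=\{A\in 2^{[n]}:\ \mathcal F\cup\{A\}\text{ is union-closed}\}$; $\mathcal F$ is $1$-dense if $\mathcal F\ne 2^{[n]}$ and $\overline{\mathcal F}=2^{[n]}$. Relative subsets: for $A,B\in\mathcal F$, $A\subseteq_{\mathcal F}B$ means that $A=B$, or $B=[n]$, or there exists $C\in\mathcal F$ with $C\neq B$ and $A\cup C=B$. For $\mathcal K\subseteq\mathcal F$, $\langle\mathcal K\rangle_{\mathcal F}=\{B\in\mathcal F:\ \exists A\in\mathcal K,\ A\subseteq_{\mathcal F}B\}$. -}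

module Defs where

open import Data.Nat using (ℕ)
open import Data.Fin.Subset using (Subset; _∪_; _⊆_; ⊤; Nonempty)
open import Data.Product using (Σ; _×_; ∃)
open import Data.Sum using (_⊎_)
open import Relation.Nullary using (¬_)
open import Relation.Binary.PropositionalEquality using (_≡_; _≢_)

Family : ℕ → Set₁
Family n = Subset n → Set

insert : ∀ {n} → Family n → Subset n → Family n
insert F A X = F X ⊎ X ≡ A

-- union-closed over [n]: contains [n], closed under pairwise unions,
-- and (convention) never contains the empty set.
UnionClosed : ∀ {n} → Family n → Set
UnionClosed {n} F =
  F ⊤ × (∀ (A : Subset n) → F A → Nonempty A)
      × (∀ (A B : Subset n) → F A → F B → F (A ∪ B))

InClosure : ∀ {n} → Family n → Subset n → Set
InClosure F A = Nonempty A × UnionClosed (insert F A)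

-- 1-dense: F ≠ 2^[n] (some nonempty subset is missing) and closure = 2^[n].
OneDense : ∀ {n} → Family n → Set
OneDense {n} F =
  UnionClosed F
  × (Σ (Subset n) λ A → Nonempty A × ¬ F A)
  × (∀ (A : Subset n) → Nonempty A → InClosure F A)

Minimal : ∀ {n} → Family n → Family n
Minimal {n} F A = F A × (∀ (C : Subset n) → F C → C ⊆ A → C ≡ A)

RelSub : ∀ {n} → Family n → Subset n → Subset n → Set
RelSub {n} F A B =
  A ≡ B ⊎ (B ≡ ⊤ ⊎ (Σ (Subset n) λ C → F C × C ≢ B × A ∪ C ≡ B))

Generated : ∀ {n} → Family n → Family n → Family n
Generated {n} F K B = F B × (Σ (Subset n) λ A → K A × RelSub F A B)

module Submission where

-- A 1-dense union-closed family F is an up-set: if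
-- Z ∈ F and Z ⊆ Y, then F ∪ {Y ─ Z} is union-closed, so Z ∪ (Y ─ Z) = Y
-- lies in F (it cannot equal Y ─ Z, which is disjoint from the nonempty Z).
-- In an up-set, A ⊆_F B follows for A ⊆ B as soon as some X ∈ F with
-- X ⊆ B does not contain A: the witness is C = X ∪ (B ─ A), which is in F,
-- satisfies A ∪ C = B, and differs from B because A ⊈ X.
-- For the theorem, B ∈ ⟨G⟩_F comes with a minimal M ⊆_F B.  If M = B then
-- A ⊆ M forces A = M = B; if B = [n] there is nothing to show; otherwise
-- M ∪ C = B with C ∈ F, C ≠ B, and one of M, C does not contain A: if
-- A ⊆ M then A = M by minimality, and A ⊆ C would give B = M ∪ C = C.

open import Defs
open import Data.Nat using (ℕ)
open import Data.Fin.Subset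
  using (Subset; _⊆_; _⊈_; _∪_; _─_; _∈_; _∉_; Nonempty; Empty; inside; outside)
open import Data.Fin.Subset.Properties
  using (_∈?_; _⊆?_; nonempty?; ⊆-refl; ⊆-antisym; p⊆p∪q; q⊆p∪q; x∈p∪q⁻; x∈p∪q⁺;
         p─q⊆p; x∈p∧x∉q⇒x∈p─q)
open import Data.Vec using (_∷_; there)
open import Data.Product using (_,_)
open import Data.Sum using (_⊎_; inj₁; inj₂; [_,_])
open import Relation.Nullary using (yes; no; contradiction)
open import Relation.Binary.PropositionalEquality
  using (_≡_; _≢_; refl; sym; trans; subst)

private
  variable
    n : ℕ

x∈p─q⇒x∉q : ∀ {x} (p q : Subset n) → x ∈ p ─ q → x ∉ q
x∈p─q⇒x∉q (_ ∷ p) (outside ∷ q) (there x∈p─q) (there x∈q) = x∈p─q⇒x∉q p q x∈p─q x∈q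
x∈p─q⇒x∉q (_ ∷ p) (inside ∷ q)  (there x∈p─q) (there x∈q) = x∈p─q⇒x∉q p q x∈p─q x∈q

∪-lub : {p q r : Subset n} → p ⊆ r → q ⊆ r → p ∪ q ⊆ r
∪-lub {p = p} {q} p⊆r q⊆r x∈p∪q = [ p⊆r , q⊆r ] (x∈p∪q⁻ p q x∈p∪q)

⊆-∪-─ : (p q : Subset n) → q ⊆ p ∪ (q ─ p)
⊆-∪-─ p q {x} x∈q with x ∈? p
... | yes x∈p = x∈p∪q⁺ (inj₁ x∈p)
... | no  x∉p = x∈p∪q⁺ (inj₂ (x∈p∧x∉q⇒x∈p─q x∈q x∉p))

Empty-─⇒⊆ : (p q : Subset n) → Empty (q ─ p) → q ⊆ p
Empty-─⇒⊆ p q empty {x} x∈q with x ∈? p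
... | yes x∈p = x∈p
... | no  x∉p = contradiction (x , x∈p∧x∉q⇒x∈p─q x∈q x∉p) empty

p⊆q⇒p∪q≡q : {p q : Subset n} → p ⊆ q → p ∪ q ≡ q
p⊆q⇒p∪q≡q {p = p} {q} p⊆q = ⊆-antisym (∪-lub p⊆q ⊆-refl) (q⊆p∪q p q)

∪-─-≡ : {p q : Subset n} → p ⊆ q → p ∪ (q ─ p) ≡ q
∪-─-≡ {p = p} {q} p⊆q = ⊆-antisym (∪-lub p⊆q (p─q⊆p q p)) (⊆-∪-─ p q)

∪-─-≢ : (p q : Subset n) → Nonempty p → p ∪ (q ─ p) ≢ q ─ p
∪-─-≢ p q (x , x∈p) p∪[q─p]≡q─p =
  x∈p─q⇒x∉q q p (subst (x ∈_) p∪[q─p]≡q─p (p⊆p∪q (q ─ p) x∈p)) x∈p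

UpClosed : Family n → Set
UpClosed {n} F = (Z Y : Subset n) → F Z → Z ⊆ Y → F Y

-- Density alone (every nonempty set is in the closure of F) makes F an
-- up-set; this is the only consequence of 1-density the theorem needs.
dense⇒upClosed : (F : Family n) →
                 ((A : Subset n) → Nonempty A → InClosure F A) → UpClosed F
dense⇒upClosed F dense Z Y fZ Z⊆Y with nonempty? (Y ─ Z)
... | no empty = subst F (⊆-antisym Z⊆Y (Empty-─⇒⊆ Z Y empty)) fZ
... | yes nonempty with dense (Y ─ Z) nonempty
... | _ , _ , nonemptyMember , unionClosed
  with unionClosed Z (Y ─ Z) (inj₁ fZ) (inj₂ refl)
...   | inj₁ fZ∪[Y─Z]     = subst F (∪-─-≡ Z⊆Y) fZ∪[Y─Z]
...   | inj₂ Z∪[Y─Z]≡Y─Z =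
  contradiction Z∪[Y─Z]≡Y─Z (∪-─-≢ Z Y (nonemptyMember Z (inj₁ fZ)))

relSub-from-witness : (F : Family n) → UpClosed F → (A B X : Subset n) →
                      F X → X ⊆ B → A ⊆ B → A ⊈ X → RelSub F A B
relSub-from-witness F upClosed A B X fX X⊆B A⊆B A⊈X =
  inj₂ (inj₂ (C , fC , C≢B , A∪C≡B))
  where
  C : Subset _
  C = X ∪ (B ─ A)

  fC : F C
  fC = upClosed X C fX (p⊆p∪q (B ─ A))

  A∩C⊆X : ∀ {x} → x ∈ A → x ∈ C → x ∈ X
  A∩C⊆X x∈A x∈C with x∈p∪q⁻ X (B ─ A) x∈C
  ... | inj₁ x∈X   = x∈X
  ... | inj₂ x∈B─A = contradiction x∈A (x∈p─q⇒x∉q B A x∈B─A)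

  C≢B : C ≢ B
  C≢B C≡B = A⊈X (λ x∈A → A∩C⊆X x∈A (subst (_ ∈_) (sym C≡B) (A⊆B x∈A)))

  A∪C≡B : A ∪ C ≡ B
  A∪C≡B = ⊆-antisym (∪-lub A⊆B (∪-lub X⊆B (p─q⊆p B A))) B⊆A∪C
    where
    B⊆A∪C : B ⊆ A ∪ C
    B⊆A∪C x∈B with x∈p∪q⁻ A (B ─ A) (⊆-∪-─ A B x∈B)
    ... | inj₁ x∈A   = x∈p∪q⁺ (inj₁ x∈A)
    ... | inj₂ x∈B─A = x∈p∪q⁺ (inj₂ (q⊆p∪q X (B ─ A) x∈B─A))

member-escapes-split : (F : Family n) (A M C B : Subset n) →
                       Minimal F M → F A → M ∪ C ≡ B → C ≢ B → A ⊈ M ⊎ A ⊈ C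
member-escapes-split F A M C B (_ , minimal) fA M∪C≡B C≢B with A ⊆? C
... | no  A⊈C = inj₂ A⊈C
... | yes A⊆C = inj₁ A⊈M
  where
  A⊈M : A ⊈ M
  A⊈M A⊆M = C≢B (trans (sym (p⊆q⇒p∪q≡q M⊆C)) M∪C≡B)
    where
    M⊆C : M ⊆ C
    M⊆C = subst (_⊆ C) (minimal A fA A⊆M) A⊆C

relSub-over-minimal : (F : Family n) → UpClosed F → (A M B : Subset n) →
                      F A → Minimal F M → RelSub F M B → A ⊆ B → RelSub F A B
relSub-over-minimal F upClosed A M B fA (_ , minimal) (inj₁ M≡B) A⊆B =
  inj₁ (trans (minimal A fA (subst (A ⊆_) (sym M≡B) A⊆B)) M≡B)
relSub-over-minimal F upClosed A M B fA minM (inj₂ (inj₁ B≡⊤)) A⊆B = inj₂ (inj₁ B≡⊤)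
relSub-over-minimal F upClosed A M B fA minM@(fM , _) (inj₂ (inj₂ (C , fC , C≢B , M∪C≡B))) A⊆B
  with member-escapes-split F A M C B minM fA M∪C≡B C≢B
... | inj₁ A⊈M = relSub-from-witness F upClosed A B M fM M⊆B A⊆B A⊈M
  where
  M⊆B : M ⊆ B
  M⊆B = subst (M ⊆_) M∪C≡B (p⊆p∪q C)
... | inj₂ A⊈C = relSub-from-witness F upClosed A B C fC C⊆B A⊆B A⊈C
  where
  C⊆B : C ⊆ B
  C⊆B = subst (C ⊆_) M∪C≡B (q⊆p∪q M C)

-- Lemma 9: only A ∈ F is needed from A ∈ ⟨G⟩_F.
lemma9 : (n : ℕ) (F : Family n) → OneDense F →
    (A B : Subset n) →
    Generated F (Minimal F) A → Generated F (Minimal F) B →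
    A ⊆ B → RelSub F A B
lemma9 n F (_ , _ , dense) A B (fA , _) (_ , M , minM , M⊆FB) =
  relSub-over-minimal F (dense⇒upClosed F dense) A M B fA minM M⊆FB
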